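{- Let $\mathcal{D}_i=(G_i,x_i,y_i)$ $(i=1,2)$ be regular dessins of types $(l_i,m_i,n_i)$, and let $\mathcal{D}=(G,x,y)$ be their parallel product, where $x=(x_1,x_2)$, $y=(y_1,y_2)$ and $G=\langle x,y\rangle\le G_1\times G_2$. Suppose that at least two of the conditions $\gcd(l_1,l_2)=1$, $\gcd(m_1,m_2)=1$, $\gcd(n_1,n_2)=1$ hold. Then $G=G_1\times G_2$.
   Context: A regular dessin is a triple $(G,x,y)$ with $G$ a finite group generated by $x,y$; its type is $(o(x),o(y),o(xy))$. The parallel product of $(G_1,x_1,y_1)$ and $(G_2,x_2,y_2)$ is the regular dessin $(G,x,y)$ where $x=(x_1,x_2)$, $y=(y_1,y_2)$ and $G$ is the subgroup of $G_1\times G_2$ generated by $x$ and $y$. -}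

module Defs where

open import Level using (Level; _⊔_)
open import Data.Nat using (ℕ; zero; suc; _≤_; _<_)
open import Data.Fin using (Fin)
open import Data.Product using (Σ; ∃; _×_; _,_)
open import Data.Sum using (_⊎_)
open import Algebra.Bundles using (Group)
import Algebra.Construct.DirectProduct as DP

private variable c ℓ : Level

module _ (G : Group c ℓ) where
  open Group G

  pow : Carrier → ℕ → Carrier
  pow x zero    = ε
  pow x (suc n) = x ∙ pow x n

  Finite : Set (c ⊔ ℓ)
  Finite = Σ ℕ λ n → Σ (Fin n → Carrier) λ f → ∀ g → ∃ λ i → f i ≈ g

  data InGen (x y : Carrier) : Carrier → Set (c ⊔ ℓ) where
    gen-x   : InGen x y x
    gen-y   : InGen x y y
    gen-ε   : InGen x y ε
    gen-∙   : ∀ {a b} → InGen x y a → InGen x y b → InGen x y (a ∙ b)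
    gen-⁻¹  : ∀ {a} → InGen x y a → InGen x y (a ⁻¹)
    gen-≈   : ∀ {a b} → a ≈ b → InGen x y a → InGen x y b

  Generates : Carrier → Carrier → Set (c ⊔ ℓ)
  Generates x y = ∀ g → InGen x y g

  IsOrder : Carrier → ℕ → Set ℓ
  IsOrder x n = (0 < n) × (pow x n ≈ ε) × (∀ k → 0 < k → pow x k ≈ ε → n ≤ k)

record RegularDessinOfType (G : Group c ℓ) (x y : Group.Carrier G) (l m n : ℕ) : Set (c ⊔ ℓ) where
  field
    finite    : Finite G
    generated : Generates G x y
    ord-x     : IsOrder G x l
    ord-y     : IsOrder G y m
    ord-xy    : IsOrder G (Group._∙_ G x y) n

_×ᴳ_ : ∀ {c₁ ℓ₁ c₂ ℓ₂} → Group c₁ ℓ₁ → Group c₂ ℓ₂ → Group (c₁ ⊔ c₂) (ℓ₁ ⊔ ℓ₂)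
_×ᴳ_ = DP.group

AtLeastTwo : ∀ {a} → Set a → Set a → Set a → Set a
AtLeastTwo A B C = (A × B) ⊎ (A × C) ⊎ (B × C)

module Submission where

-- Write H = ⟨(x₁,x₂),(y₁,y₂)⟩ ≤ G₁ × G₂.  If (a,b) ∈ H where
-- a^p = 1, b^q = 1 and gcd p q = 1, then Bézout gives k with k ≡ ±1 (mod p)
-- and k ≡ 0 (mod q), so (a,b)^k = (a^{±1},1) and hence (a,1) ∈ H; by
-- symmetry (1,b) ∈ H.  Two coprimality conditions therefore split two of
-- the three elements x, y, xy into their factors, and any two of x, y, xy
-- generate the same group as x and y.  The injections Gᵢ → G₁ × G₂ then
-- carry G₁ × 1 and 1 × G₂ into H, so H is everything.

open import Defs
open import Level using (Level; _⊔_)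
open import Data.Nat using (ℕ; zero; suc; _+_; _*_)
open import Data.Nat.GCD using (gcd; gcd-GCD; gcd-comm; module Bézout)
open import Data.Product using (_,_; Σ; _×_; proj₁; proj₂; swap)
open import Data.Sum using (_⊎_; inj₁; inj₂)
open import Algebra.Bundles using (Group)
open import Algebra.Morphism.Structures using (module GroupMorphisms)
open import Relation.Binary.PropositionalEquality using (_≡_)
import Relation.Binary.PropositionalEquality as ≡
import Algebra.Properties.Group as GroupProperties

IsHom : ∀ {c₁ ℓ₁ c₂ ℓ₂} (G : Group c₁ ℓ₁) (H : Group c₂ ℓ₂) →
        (Group.Carrier G → Group.Carrier H) → Set (c₁ ⊔ ℓ₁ ⊔ ℓ₂)
IsHom G H = GroupMorphisms.IsGroupHomomorphism (Group.rawGroup G) (Group.rawGroup H)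

module Powers {c ℓ} (G : Group c ℓ) where
  open Group G

  pow-+ : ∀ a m n → pow G a (m + n) ≈ pow G a m ∙ pow G a n
  pow-+ a zero    n = sym (identityˡ _)
  pow-+ a (suc m) n = trans (∙-congˡ (pow-+ a m n)) (sym (assoc _ _ _))

  pow-multiple : ∀ a p → pow G a p ≈ ε → ∀ k → pow G a (k * p) ≈ ε
  pow-multiple a p ap≈ε zero    = refl
  pow-multiple a p ap≈ε (suc k) = begin
    pow G a (p + k * p)          ≈⟨ pow-+ a p (k * p) ⟩
    pow G a p ∙ pow G a (k * p)  ≈⟨ ∙-cong ap≈ε (pow-multiple a p ap≈ε k) ⟩
    ε ∙ ε                        ≈⟨ identityˡ ε ⟩
    ε                            ∎
    where open import Relation.Binary.Reasoning.Setoid setoid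

  pow-≡ : ∀ a {m n} → m ≡ n → pow G a m ≈ pow G a n
  pow-≡ a m≡n = reflexive (≡.cong (pow G a) m≡n)

record CoprimeExponents {c₁ ℓ₁ c₂ ℓ₂} (G : Group c₁ ℓ₁) (H : Group c₂ ℓ₂)
       (a : Group.Carrier G) (b : Group.Carrier H) : Set (ℓ₁ ⊔ ℓ₂) where
  field
    {p q}   : ℕ
    a^p≈ε   : Group._≈_ G (pow G a p) (Group.ε G)
    b^q≈ε   : Group._≈_ H (pow H b q) (Group.ε H)
    coprime : gcd p q ≡ 1

orders-coprime : ∀ {c₁ ℓ₁ c₂ ℓ₂} {G : Group c₁ ℓ₁} {H : Group c₂ ℓ₂} {a b p q} →
  IsOrder G a p → IsOrder H b q → gcd p q ≡ 1 → CoprimeExponents G H a b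
orders-coprime {p = p} {q} (_ , a^p≈ε , _) (_ , b^q≈ε , _) coprime = record
  { p = p ; q = q ; a^p≈ε = a^p≈ε ; b^q≈ε = b^q≈ε ; coprime = coprime }

CoprimeExponents-swap : ∀ {c₁ ℓ₁ c₂ ℓ₂} {G : Group c₁ ℓ₁} {H : Group c₂ ℓ₂} {a b} →
  CoprimeExponents G H a b → CoprimeExponents H G b a
CoprimeExponents-swap ce = record
  { p = q ; q = p ; a^p≈ε = b^q≈ε ; b^q≈ε = a^p≈ε ; coprime = ≡.trans (gcd-comm q p) coprime }
  where open CoprimeExponents ce

SeparatingExponent : ∀ {c₁ ℓ₁ c₂ ℓ₂} (G : Group c₁ ℓ₁) (H : Group c₂ ℓ₂) →
  Group.Carrier G → Group.Carrier H → ℕ → Set (ℓ₁ ⊔ ℓ₂)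
SeparatingExponent G H a b k =
  (Group._≈_ G (pow G a k) a ⊎ Group._≈_ G (pow G a k) (Group._⁻¹ G a))
  × Group._≈_ H (pow H b k) (Group.ε H)

coprime-exponent : ∀ {c₁ ℓ₁ c₂ ℓ₂} (G : Group c₁ ℓ₁) (H : Group c₂ ℓ₂) {a b} →
  CoprimeExponents G H a b → Σ ℕ (SeparatingExponent G H a b)
coprime-exponent G H {a} {b} ce =
  from-bezout (≡.subst (λ d → Bézout.Identity d p q) coprime (Bézout.identity (gcd-GCD p q)))
  where
  open CoprimeExponents ce
  module G = Group G
  open Powers G using (pow-≡; pow-multiple)
  open Powers H using () renaming (pow-multiple to pow-multipleᴴ)

  -- k = jq works for any Bézout identity 1 ± jq = ip.
  from-bezout : Bézout.Identity 1 p q → Σ ℕ (SeparatingExponent G H a b)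
  from-bezout (Bézout.+- i j 1+jq≡ip) =
    j * q , inj₂ (GroupProperties.inverseʳ-unique G a _ a∙aʲᑫ≈ε) , pow-multipleᴴ b q b^q≈ε j
    where
    -- a · a^{jq} = a^{1+jq} = a^{ip} = 1
    a∙aʲᑫ≈ε : a G.∙ pow G a (j * q) G.≈ G.ε
    a∙aʲᑫ≈ε = G.trans (pow-≡ a 1+jq≡ip) (pow-multiple a p a^p≈ε i)
  from-bezout (Bézout.-+ i j 1+ip≡jq) =
    j * q , inj₁ aʲᑫ≈a , pow-multipleᴴ b q b^q≈ε j
    where
    -- a^{jq} = a^{1+ip} = a · a^{ip} = a
    aʲᑫ≈a : pow G a (j * q) G.≈ a
    aʲᑫ≈a = G.trans (pow-≡ a (≡.sym 1+ip≡jq))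
              (G.trans (G.∙-congˡ (pow-multiple a p a^p≈ε i)) (G.identityʳ a))

module Generated {c ℓ} (G : Group c ℓ) where
  open Group G
  open GroupProperties G using (⁻¹-involutive; y≈x\\z; x≈z//y)

  InGen-least : ∀ {u v a b} → InGen G u v a → InGen G u v b →
                ∀ {g} → InGen G a b g → InGen G u v g
  InGen-least a∈ b∈ gen-x        = a∈
  InGen-least a∈ b∈ gen-y        = b∈
  InGen-least a∈ b∈ gen-ε        = gen-ε
  InGen-least a∈ b∈ (gen-∙ g h)  = gen-∙ (InGen-least a∈ b∈ g) (InGen-least a∈ b∈ h)
  InGen-least a∈ b∈ (gen-⁻¹ g)   = gen-⁻¹ (InGen-least a∈ b∈ g)
  InGen-least a∈ b∈ (gen-≈ e g)  = gen-≈ e (InGen-least a∈ b∈ g)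

  InGen-pow : ∀ {u v z} k → InGen G u v z → InGen G u v (pow G z k)
  InGen-pow zero    z∈ = gen-ε
  InGen-pow (suc k) z∈ = gen-∙ z∈ (InGen-pow k z∈)

  InGen-⁻¹-reflect : ∀ {u v a} → InGen G u v (a ⁻¹) → InGen G u v a
  InGen-⁻¹-reflect a⁻¹∈ = gen-≈ (⁻¹-involutive _) (gen-⁻¹ a⁻¹∈)

  -- ⟨x, xy⟩ = ⟨y, xy⟩ = ⟨x, y⟩, because y = x⁻¹(xy) and x = (xy)y⁻¹.
  generates-x-xy : ∀ {x y} → Generates G x y → Generates G x (x ∙ y)
  generates-x-xy {x} {y} gen g = InGen-least gen-x y∈ (gen g)
    where
    y∈ : InGen G x (x ∙ y) y
    y∈ = gen-≈ (sym (y≈x\\z x y (x ∙ y) refl)) (gen-∙ (gen-⁻¹ gen-x) gen-y)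

  generates-y-xy : ∀ {x y} → Generates G x y → Generates G y (x ∙ y)
  generates-y-xy {x} {y} gen g = InGen-least x∈ gen-x (gen g)
    where
    x∈ : InGen G y (x ∙ y) x
    x∈ = gen-≈ (sym (x≈z//y x y (x ∙ y) refl)) (gen-∙ gen-y (gen-⁻¹ gen-x))

module _ {c₁ ℓ₁ c₂ ℓ₂} {G : Group c₁ ℓ₁} {H : Group c₂ ℓ₂}
         {f : Group.Carrier G → Group.Carrier H} (hom : IsHom G H f) where
  open Group H using (sym)
  open GroupMorphisms.IsGroupHomomorphism hom using (⟦⟧-cong; homo; ε-homo; ⁻¹-homo)

  InGen-map : ∀ {x y g} → InGen G x y g → InGen H (f x) (f y) (f g)
  InGen-map gen-x       = gen-x
  InGen-map gen-y       = gen-y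
  InGen-map gen-ε       = gen-≈ (sym ε-homo) gen-ε
  InGen-map (gen-∙ g h) = gen-≈ (sym (homo _ _)) (gen-∙ (InGen-map g) (InGen-map h))
  InGen-map (gen-⁻¹ g)  = gen-≈ (sym (⁻¹-homo _)) (gen-⁻¹ (InGen-map g))
  InGen-map (gen-≈ e g) = gen-≈ (⟦⟧-cong e) (InGen-map g)

module Product {c₁ ℓ₁ c₂ ℓ₂} (G₁ : Group c₁ ℓ₁) (G₂ : Group c₂ ℓ₂) where
  private
    module G₁ = Group G₁
    module G₂ = Group G₂
    module PG₂ = GroupProperties G₂
    P = G₁ ×ᴳ G₂
  open Group P using (_≈_)
  open Generated P using (InGen-pow; InGen-⁻¹-reflect)

  pow-× : ∀ a b k → pow P (a , b) k ≈ (pow G₁ a k , pow G₂ b k)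
  pow-× a b zero    = G₁.refl , G₂.refl
  pow-× a b (suc k) = G₁.∙-congˡ (proj₁ (pow-× a b k)) , G₂.∙-congˡ (proj₂ (pow-× a b k))

  InGen-pow-× : ∀ {u v a b c d} → InGen P u v (a , b) →
    ∀ k → pow G₁ a k G₁.≈ c → pow G₂ b k G₂.≈ d → InGen P u v (c , d)
  InGen-pow-× {a = a} {b} ab∈ k aᵏ≈c bᵏ≈d =
    gen-≈ (G₁.trans (proj₁ (pow-× a b k)) aᵏ≈c , G₂.trans (proj₂ (pow-× a b k)) bᵏ≈d)
          (InGen-pow k ab∈)

  swap-hom : IsHom P (G₂ ×ᴳ G₁) swap
  swap-hom = record
    { isMonoidHomomorphism = record
      { isMagmaHomomorphism = record
        { isRelHomomorphism = record { cong = swap }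
        ; homo = λ _ _ → G₂.refl , G₁.refl }
      ; ε-homo = G₂.refl , G₁.refl }
    ; ⁻¹-homo = λ _ → G₂.refl , G₁.refl }

  inj₁-hom : IsHom G₁ P (λ a → a , G₂.ε)
  inj₁-hom = record
    { isMonoidHomomorphism = record
      { isMagmaHomomorphism = record
        { isRelHomomorphism = record { cong = λ a≈b → a≈b , G₂.refl }
        ; homo = λ _ _ → G₁.refl , G₂.sym (G₂.identityˡ G₂.ε) }
      ; ε-homo = G₁.refl , G₂.refl }
    ; ⁻¹-homo = λ _ → G₁.refl , G₂.sym PG₂.ε⁻¹≈ε }

  split-left : ∀ {u v a b} → CoprimeExponents G₁ G₂ a b →
    InGen P u v (a , b) → InGen P u v (a , G₂.ε)
  split-left ce ab∈ with coprime-exponent G₁ G₂ ce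
  ... | k , inj₁ aᵏ≈a , bᵏ≈ε   = InGen-pow-× ab∈ k aᵏ≈a bᵏ≈ε
  ... | k , inj₂ aᵏ≈a⁻¹ , bᵏ≈ε =
    InGen-⁻¹-reflect (InGen-pow-× ab∈ k aᵏ≈a⁻¹ (G₂.trans bᵏ≈ε (G₂.sym PG₂.ε⁻¹≈ε)))

module ProductGeneration {c₁ ℓ₁ c₂ ℓ₂} (G₁ : Group c₁ ℓ₁) (G₂ : Group c₂ ℓ₂) where
  private
    module G₁ = Group G₁
    module G₂ = Group G₂
    P = G₁ ×ᴳ G₂
  open Product G₁ G₂ using (swap-hom; inj₁-hom; split-left)
  open Product G₂ G₁ using () renaming
    (swap-hom to swap-hom⁻¹; inj₁-hom to inj₂-hom′; split-left to split-left′)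
  open Generated P using (InGen-least)

  split-right : ∀ {u v a b} → CoprimeExponents G₁ G₂ a b →
    InGen P u v (a , b) → InGen P u v (G₁.ε , b)
  split-right ce ab∈ =
    InGen-map swap-hom⁻¹ (split-left′ (CoprimeExponents-swap ce) (InGen-map swap-hom ab∈))

  InGen-inj₂ : ∀ {x y g} → InGen G₂ x y g → InGen P (G₁.ε , x) (G₁.ε , y) (G₁.ε , g)
  InGen-inj₂ g∈ = InGen-map swap-hom⁻¹ (InGen-map {G = G₂} {H = G₂ ×ᴳ G₁} inj₂-hom′ g∈)

  generates-product : ∀ {u v a₁ a₂ b₁ b₂} →
    InGen P u v (a₁ , a₂) → InGen P u v (b₁ , b₂) →
    CoprimeExponents G₁ G₂ a₁ a₂ → CoprimeExponents G₁ G₂ b₁ b₂ →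
    Generates G₁ a₁ b₁ → Generates G₂ a₂ b₂ → Generates P u v
  generates-product {u} {v} a∈ b∈ ce-a ce-b gen₁ gen₂ (g₁ , g₂) =
    gen-≈ (G₁.identityʳ g₁ , G₂.identityˡ g₂) (gen-∙ g₁∈ g₂∈)
    where
    g₁∈ : InGen P u v (g₁ , G₂.ε)
    g₁∈ = InGen-least (split-left ce-a a∈) (split-left ce-b b∈)
            (InGen-map inj₁-hom (gen₁ g₁))
    g₂∈ : InGen P u v (G₁.ε , g₂)
    g₂∈ = InGen-least (split-right ce-a a∈) (split-right ce-b b∈) (InGen-inj₂ (gen₂ g₂))

proposition3p4 : ∀ {c₁ ℓ₁ c₂ ℓ₂ : Level} (G₁ : Group c₁ ℓ₁) (G₂ : Group c₂ ℓ₂)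
    (x₁ y₁ : Group.Carrier G₁) (x₂ y₂ : Group.Carrier G₂) (l₁ m₁ n₁ l₂ m₂ n₂ : ℕ) →
    RegularDessinOfType G₁ x₁ y₁ l₁ m₁ n₁ →
    RegularDessinOfType G₂ x₂ y₂ l₂ m₂ n₂ →
    AtLeastTwo (gcd l₁ l₂ ≡ 1) (gcd m₁ m₂ ≡ 1) (gcd n₁ n₂ ≡ 1) →
    Generates (G₁ ×ᴳ G₂) (x₁ , x₂) (y₁ , y₂)
proposition3p4 G₁ G₂ x₁ y₁ x₂ y₂ l₁ m₁ n₁ l₂ m₂ n₂ D₁ D₂ = by-cases
  where
  open ProductGeneration G₁ G₂ using (generates-product)
  module D₁ = RegularDessinOfType D₁
  module D₂ = RegularDessinOfType D₂

  xy∈ : InGen (G₁ ×ᴳ G₂) (x₁ , x₂) (y₁ , y₂) (Group._∙_ G₁ x₁ y₁ , Group._∙_ G₂ x₂ y₂)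
  xy∈ = gen-∙ gen-x gen-y

  by-cases : AtLeastTwo (gcd l₁ l₂ ≡ 1) (gcd m₁ m₂ ≡ 1) (gcd n₁ n₂ ≡ 1) →
             Generates (G₁ ×ᴳ G₂) (x₁ , x₂) (y₁ , y₂)
  by-cases (inj₁ (l-coprime , m-coprime)) =
    generates-product gen-x gen-y
      (orders-coprime D₁.ord-x D₂.ord-x l-coprime) (orders-coprime D₁.ord-y D₂.ord-y m-coprime)
      D₁.generated D₂.generated
  by-cases (inj₂ (inj₁ (l-coprime , n-coprime))) =
    generates-product gen-x xy∈
      (orders-coprime D₁.ord-x D₂.ord-x l-coprime) (orders-coprime D₁.ord-xy D₂.ord-xy n-coprime)
      (Generated.generates-x-xy G₁ D₁.generated) (Generated.generates-x-xy G₂ D₂.generated)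
  by-cases (inj₂ (inj₂ (m-coprime , n-coprime))) =
    generates-product gen-y xy∈
      (orders-coprime D₁.ord-y D₂.ord-y m-coprime) (orders-coprime D₁.ord-xy D₂.ord-xy n-coprime)
      (Generated.generates-y-xy G₁ D₁.generated) (Generated.generates-y-xy G₂ D₂.generated)
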